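{- Let $G$ be a graph with minimum degree $\delta$, and let $S$ and $B$ be connected induced subgraphs of $G$ with $V(B)=N_G[V(S)]$. If $\max_{u,v\in V(S)}d_B(u,v)=3$ and there exist $a,d\in V(S)$ with $d_B(a,d)=d_S(a,d)=3$, then there is an edge $\{u,v\}$ of $S$ with $|N_G[u]\cup N_G[v]|\ge\frac{4}{3}(\delta+1)$.
   Context: $d_H(x,y)$ denotes the distance between $x$ and $y$ in the graph $H$. $N_G[x]$ is the closed neighborhood of $x$ in $G$, and $N_G[X]$ for a vertex set $X$ is the set of vertices at distance at most $1$ from $X$ in $G$. -}

module Defs where

open import Data.Nat using (ℕ; zero; suc; _≤_; _<_; _*_; _+_)
open import Data.Bool using (Bool; true; false; _∨_)
open import Data.Fin using (Fin; _≟_)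
open import Data.Fin.Subset using (Subset; _∈_; _∪_; ∣_∣)
open import Data.Vec using (tabulate)
open import Data.Product using (Σ; _×_; ∃; ∃-syntax)
open import Relation.Binary.PropositionalEquality using (_≡_)
open import Relation.Nullary using (¬_; does)
open import Function.Bundles using (_⇔_)
open import Data.Sum using (_⊎_)

record Graph : Set where
  field
    n      : ℕ
    adj    : Fin n → Fin n → Bool
    sym    : ∀ u v → adj u v ≡ adj v u
    irrefl : ∀ u → adj u u ≡ false
open Graph public

module _ (G : Graph) where

  Adj : Fin (n G) → Fin (n G) → Set
  Adj u v = adj G u v ≡ true

  nbhd : Fin (n G) → Subset (n G)
  nbhd u = tabulate (adj G u)

  degree : Fin (n G) → ℕ
  degree u = ∣ nbhd u ∣

  MinDegree : ℕ → Set
  MinDegree δ = (∀ u → δ ≤ degree u) × (∃[ u ] degree u ≡ δ)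

  closedNbhd : Fin (n G) → Subset (n G)
  closedNbhd u = tabulate (λ w → does (w ≟ u) ∨ adj G u w)

  InClosedNbhdSet : Subset (n G) → Fin (n G) → Set
  InClosedNbhdSet X x = ∃[ y ] (y ∈ X × (x ≡ y ⊎ Adj y x))

  data WalkIn (X : Subset (n G)) : Fin (n G) → Fin (n G) → ℕ → Set where
    nil  : ∀ {u} → u ∈ X → WalkIn X u u zero
    cons : ∀ {u w v k} → u ∈ X → Adj u w → WalkIn X w v k → WalkIn X u v (suc k)

  DistIn : Subset (n G) → Fin (n G) → Fin (n G) → ℕ → Set
  DistIn X u v k = WalkIn X u v k × (∀ m → m < k → ¬ WalkIn X u v m)

  ConnectedIn : Subset (n G) → Set
  ConnectedIn X = (∃[ x ] x ∈ X) × (∀ u v → u ∈ X → v ∈ X → ∃[ k ] WalkIn X u v k)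

module Submission where

-- Let a – b – c – d be a shortest path of S from a to d; it
-- exists because d_S(a,d) = 3, and all four vertices lie in S.  Since
-- N_G[a] ⊆ N_G[S] = V(B) and d_B(a,d) = 3, the closed neighbourhoods
-- N[a] and N[d] are disjoint (a common vertex would give an a–d walk of
-- length ≤ 2 in B).  For any sets with A ∩ D = ∅ one has, pointwise,
--   |A| + |B| + |C| + |D|  ≤  |A ∪ B| + |B ∪ C| + |C ∪ D|,
-- and every closed neighbourhood has at least δ + 1 vertices, so the three
-- edges ab, bc, cd have union sizes summing to at least 4(δ + 1).  By
-- pigeonhole one of them has |N[u] ∪ N[v]| ≥ 4(δ + 1)/3.

open import Defs hiding (sym)
open import Data.Nat using (ℕ; _≤_; _<_; _*_; _+_; _⊔_; z≤n; s≤s)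
open import Data.Nat.Properties
  using (≤-trans; +-comm; +-mono-≤; ≤ᵇ⇒≤; ⊔-sel; m≤m⊔n; m≤n⊔m; m≤n⇒m≤n⊔o)
open import Data.Nat.Solver using (module +-*-Solver)
open import Data.Bool using (Bool; true; false; _∨_)
open import Data.Fin using (Fin; _≟_)
open import Data.Fin.Subset using (Subset; _∈_; _∪_; ∣_∣)
open import Data.Fin.Subset.Properties using (p⊂q⇒∣p∣<∣q∣)
open import Data.Vec using ([]; _∷_; tabulate; here; there)
open import Data.Vec.Properties using (lookup∘tabulate; []=⇒lookup; lookup⇒[]=)
open import Data.Product using (_×_; ∃-syntax; _,_)
open import Data.Sum using (_⊎_; inj₁; inj₂)
open import Data.Empty using (⊥; ⊥-elim)
open import Data.Unit using (tt)
open import Relation.Nullary using (¬_; does; yes; no)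
open import Relation.Binary.PropositionalEquality using (_≡_; refl; sym; trans; subst)
open import Function.Bundles using (_⇔_; Equivalence)

sum≤3*max : ∀ x y z → x + y + z ≤ 3 * (x ⊔ y ⊔ z)
sum≤3*max x y z = subst (x + y + z ≤_) (triple (x ⊔ y ⊔ z))
  (+-mono-≤ (+-mono-≤ (m≤n⇒m≤n⊔o z (m≤m⊔n x y)) (m≤n⇒m≤n⊔o z (m≤n⊔m x y)))
            (m≤n⊔m (x ⊔ y) z))
  where
  triple : ∀ m → m + m + m ≡ 3 * m
  triple = solve 1 (λ m → m :+ m :+ m := con 3 :* m) refl
    where open +-*-Solver

pigeonhole₃ : ∀ k x y z → k ≤ x + y + z → k ≤ 3 * x ⊎ k ≤ 3 * y ⊎ k ≤ 3 * z
pigeonhole₃ k x y z k≤sum with ≤-trans k≤sum (sum≤3*max x y z)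
... | k≤3max with ⊔-sel (x ⊔ y) z | ⊔-sel x y
...   | inj₂ max≡z | _        = inj₂ (inj₂ (subst (λ t → k ≤ 3 * t) max≡z k≤3max))
...   | inj₁ max≡xy | inj₁ xy≡x =
  inj₁ (subst (λ t → k ≤ 3 * t) (trans max≡xy xy≡x) k≤3max)
...   | inj₁ max≡xy | inj₂ xy≡y =
  inj₂ (inj₁ (subst (λ t → k ≤ 3 * t) (trans max≡xy xy≡y) k≤3max))

bit : Bool → ℕ
bit true  = 1
bit false = 0

∣x∷p∣ : ∀ {m} x (p : Subset m) → ∣ x ∷ p ∣ ≡ bit x + ∣ p ∣
∣x∷p∣ true  p = refl
∣x∷p∣ false p = refl

chain-bit : ∀ a b c d → ¬ (a ≡ true × d ≡ true) →
  bit a + bit b + bit c + bit d ≤ bit (a ∨ b) + bit (b ∨ c) + bit (c ∨ d)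
chain-bit true  _     _     true  a∩d=∅ = ⊥-elim (a∩d=∅ (refl , refl))
chain-bit true  true  true  false _ = ≤ᵇ⇒≤ _ _ tt
chain-bit true  true  false false _ = ≤ᵇ⇒≤ _ _ tt
chain-bit true  false true  false _ = ≤ᵇ⇒≤ _ _ tt
chain-bit true  false false false _ = ≤ᵇ⇒≤ _ _ tt
chain-bit false true  true  true  _ = ≤ᵇ⇒≤ _ _ tt
chain-bit false true  true  false _ = ≤ᵇ⇒≤ _ _ tt
chain-bit false true  false true  _ = ≤ᵇ⇒≤ _ _ tt
chain-bit false true  false false _ = ≤ᵇ⇒≤ _ _ tt
chain-bit false false true  true  _ = ≤ᵇ⇒≤ _ _ tt
chain-bit false false true  false _ = ≤ᵇ⇒≤ _ _ tt
chain-bit false false false true  _ = ≤ᵇ⇒≤ _ _ tt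
chain-bit false false false false _ = ≤ᵇ⇒≤ _ _ tt

chain-union-bound : ∀ {m} (A B C D : Subset m) → (∀ {i} → i ∈ A → i ∈ D → ⊥) →
  ∣ A ∣ + ∣ B ∣ + ∣ C ∣ + ∣ D ∣ ≤ ∣ A ∪ B ∣ + ∣ B ∪ C ∣ + ∣ C ∪ D ∣
chain-union-bound [] [] [] [] _ = z≤n
chain-union-bound (a ∷ A) (b ∷ B) (c ∷ C) (d ∷ D) A∩D=∅
  rewrite ∣x∷p∣ a A | ∣x∷p∣ b B | ∣x∷p∣ c C | ∣x∷p∣ d D
        | ∣x∷p∣ (a ∨ b) (A ∪ B) | ∣x∷p∣ (b ∨ c) (B ∪ C) | ∣x∷p∣ (c ∨ d) (C ∪ D)
  = subst₂-≤ (interchange₄ (bit a) (bit b) (bit c) (bit d) (∣ A ∣) (∣ B ∣) (∣ C ∣) (∣ D ∣))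
             (interchange₃ (bit (a ∨ b)) (bit (b ∨ c)) (bit (c ∨ d))
                           (∣ A ∪ B ∣) (∣ B ∪ C ∣) (∣ C ∪ D ∣))
             (+-mono-≤ (chain-bit a b c d head-disjoint)
                       (chain-union-bound A B C D (λ i∈A i∈D → A∩D=∅ (there i∈A) (there i∈D))))
  where
  head-disjoint : ¬ (a ≡ true × d ≡ true)
  head-disjoint (refl , refl) = A∩D=∅ here here
  subst₂-≤ : ∀ {p q r s} → p ≡ q → r ≡ s → p ≤ r → q ≤ s
  subst₂-≤ refl refl p≤r = p≤r
  interchange₄ : ∀ a b c d a′ b′ c′ d′ →
    (a + b + c + d) + (a′ + b′ + c′ + d′) ≡ (a + a′) + (b + b′) + (c + c′) + (d + d′)
  interchange₄ = solve 8 (λ a b c d a′ b′ c′ d′ →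
    (a :+ b :+ c :+ d) :+ (a′ :+ b′ :+ c′ :+ d′)
      := (a :+ a′) :+ (b :+ b′) :+ (c :+ c′) :+ (d :+ d′)) refl
    where open +-*-Solver
  interchange₃ : ∀ x y z x′ y′ z′ →
    (x + y + z) + (x′ + y′ + z′) ≡ (x + x′) + (y + y′) + (z + z′)
  interchange₃ = solve 6 (λ x y z x′ y′ z′ →
    (x :+ y :+ z) :+ (x′ :+ y′ :+ z′) := (x :+ x′) :+ (y :+ y′) :+ (z :+ z′)) refl
    where open +-*-Solver

∈-tabulate⁻ : ∀ {m} (f : Fin m → Bool) {i} → i ∈ tabulate f → f i ≡ true
∈-tabulate⁻ f {i} i∈ = trans (sym (lookup∘tabulate f i)) ([]=⇒lookup i∈)

∈-tabulate⁺ : ∀ {m} (f : Fin m → Bool) {i} → f i ≡ true → i ∈ tabulate f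
∈-tabulate⁺ f {i} fi = lookup⇒[]= i _ (trans (lookup∘tabulate f i) fi)

module _ (G : Graph) where

  Adj-sym : ∀ {u v} → Adj G u v → Adj G v u
  Adj-sym {u} {v} uv = trans (sym (Graph.sym G u v)) uv

  ∈closedNbhd⁻ : ∀ {u w} → w ∈ closedNbhd G u → w ≡ u ⊎ Adj G u w
  ∈closedNbhd⁻ {u} {w} w∈ with w ≟ u | ∈-tabulate⁻ (λ x → does (x ≟ u) ∨ adj G u x) w∈
  ... | yes w≡u | _  = inj₁ w≡u
  ... | no _    | uw = inj₂ uw

  ∈closedNbhd⁺ : ∀ {u w} → w ≡ u ⊎ Adj G u w → w ∈ closedNbhd G u
  ∈closedNbhd⁺ {u} {w} near = ∈-tabulate⁺ (λ x → does (x ≟ u) ∨ adj G u x) (holds near)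
    where
    holds : w ≡ u ⊎ Adj G u w → does (w ≟ u) ∨ adj G u w ≡ true
    holds near with w ≟ u
    ... | yes _ = refl
    holds (inj₁ w≡u) | no w≢u = ⊥-elim (w≢u w≡u)
    holds (inj₂ uw)  | no _   = uw

  -- N[u] is N(u) together with u ∉ N(u), hence |N[u]| ≥ deg(u) + 1.
  degree<∣closedNbhd∣ : ∀ u → degree G u < ∣ closedNbhd G u ∣
  degree<∣closedNbhd∣ u =
    p⊂q⇒∣p∣<∣q∣ (N⊆N[u] , u , ∈closedNbhd⁺ (inj₁ refl) , u∉N)
    where
    N⊆N[u] : ∀ {w} → w ∈ nbhd G u → w ∈ closedNbhd G u
    N⊆N[u] w∈N = ∈closedNbhd⁺ (inj₂ (∈-tabulate⁻ (adj G u) w∈N))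
    u∉N : ¬ (u ∈ nbhd G u)
    u∉N u∈N with trans (sym (irrefl G u)) (∈-tabulate⁻ (adj G u) u∈N)
    ... | ()

  ∣closedNbhd∣≥ : ∀ {δ} → (∀ u → δ ≤ degree G u) → ∀ u → δ + 1 ≤ ∣ closedNbhd G u ∣
  ∣closedNbhd∣≥ {δ} δ≤deg u =
    subst (_≤ ∣ closedNbhd G u ∣) (+-comm 1 δ) (≤-trans (s≤s (δ≤deg u)) (degree<∣closedNbhd∣ u))

  closedNbhds-disjoint : ∀ {X a d} → a ∈ X → d ∈ X → (∀ {w} → Adj G a w → w ∈ X) →
    (∀ k → k < 3 → ¬ WalkIn G X a d k) →
    ∀ {i} → i ∈ closedNbhd G a → i ∈ closedNbhd G d → ⊥
  closedNbhds-disjoint a∈X d∈X N[a]⊆X far i∈N[a] i∈N[d]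
    with ∈closedNbhd⁻ i∈N[a] | ∈closedNbhd⁻ i∈N[d]
  ... | inj₁ refl | inj₁ refl = far 0 (s≤s z≤n) (nil a∈X)
  ... | inj₁ refl | inj₂ di   = far 1 (s≤s (s≤s z≤n)) (cons a∈X (Adj-sym di) (nil d∈X))
  ... | inj₂ ai   | inj₁ refl = far 1 (s≤s (s≤s z≤n)) (cons a∈X ai (nil d∈X))
  ... | inj₂ ai   | inj₂ di   =
    far 2 (s≤s (s≤s (s≤s z≤n))) (cons a∈X ai (cons (N[a]⊆X ai) (Adj-sym di) (nil d∈X)))

  path-union-bound : ∀ {δ} → (∀ u → δ ≤ degree G u) → ∀ a b c d →
    (∀ {i} → i ∈ closedNbhd G a → i ∈ closedNbhd G d → ⊥) →
    4 * (δ + 1) ≤ ∣ closedNbhd G a ∪ closedNbhd G b ∣ + ∣ closedNbhd G b ∪ closedNbhd G c ∣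
                  + ∣ closedNbhd G c ∪ closedNbhd G d ∣
  path-union-bound {δ} δ≤deg a b c d disjoint =
    ≤-trans (subst (_≤ ∣ N[ a ] ∣ + ∣ N[ b ] ∣ + ∣ N[ c ] ∣ + ∣ N[ d ] ∣) (four (δ + 1))
              (+-mono-≤ (+-mono-≤ (+-mono-≤ (size a) (size b)) (size c)) (size d)))
            (chain-union-bound N[ a ] N[ b ] N[ c ] N[ d ] disjoint)
    where
    N[_] : Fin (n G) → Subset (n G)
    N[_] = closedNbhd G
    size : ∀ u → δ + 1 ≤ ∣ closedNbhd G u ∣
    size = ∣closedNbhd∣≥ δ≤deg
    four : ∀ k → k + k + k + k ≡ 4 * k
    four = solve 1 (λ k → k :+ k :+ k :+ k := con 4 :* k) refl
      where open +-*-Solver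

lemma5 : (G : Graph) (δ : ℕ) → MinDegree G δ →
    (S B : Subset (n G)) →
    ConnectedIn G S → ConnectedIn G B →
    (∀ x → (x ∈ B) ⇔ InClosedNbhdSet G S x) →
    (∀ u v → u ∈ S → v ∈ S → ∃[ k ] (DistIn G B u v k × k ≤ 3)) →
    (∃[ u ] ∃[ v ] (u ∈ S × v ∈ S × DistIn G B u v 3)) →
    (∃[ a ] ∃[ d ] (a ∈ S × d ∈ S × DistIn G B a d 3 × DistIn G S a d 3)) →
    ∃[ u ] ∃[ v ] (u ∈ S × v ∈ S × Adj G u v ×
    4 * (δ + 1) ≤ 3 * ∣ closedNbhd G u ∪ closedNbhd G v ∣)
lemma5 G δ (δ≤deg , _) S B _ _ B≡N[S] _ _
  (a , d , a∈S , d∈S , (_ , far-in-B) ,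
   (cons {w = b} _ ab (cons {w = c} b∈S bc (cons c∈S cd (nil _))) , _))
  with pigeonhole₃ (4 * (δ + 1)) (∣ N[ a ] ∪ N[ b ] ∣) (∣ N[ b ] ∪ N[ c ] ∣) (∣ N[ c ] ∪ N[ d ] ∣)
                   (path-union-bound G δ≤deg a b c d disjoint)
  where
  N[_] : Fin (n G) → Subset (n G)
  N[_] = closedNbhd G
  inB : ∀ {x} y → y ∈ S → x ≡ y ⊎ Adj G y x → x ∈ B
  inB {x} y y∈S near = Equivalence.from (B≡N[S] x) (y , y∈S , near)
  disjoint : ∀ {i} → i ∈ closedNbhd G a → i ∈ closedNbhd G d → ⊥
  disjoint = closedNbhds-disjoint G (inB a a∈S (inj₁ refl)) (inB d d∈S (inj₁ refl))
                                    (λ aw → inB a a∈S (inj₂ aw)) far-in-B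
... | inj₁ bound        = a , b , a∈S , b∈S , ab , bound
... | inj₂ (inj₁ bound) = b , c , b∈S , c∈S , bc , bound
... | inj₂ (inj₂ bound) = c , d , c∈S , d∈S , cd , bound
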